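{- Let $\Gamma$ be a finite, simple, connected amply regular graph with diameter $d \ge 4$ and parameters $(v,k,\lambda,\mu)$, where $k\ge 5$ is odd and $\mu = \frac{k-1}{2}$. Then $\lambda = 0$ and $d \le 5$.
   Context: An amply regular graph with parameters $(v,k,\lambda,\mu)$ is a $k$-regular graph on $v$ vertices in which any two adjacent vertices have exactly $\lambda$ common neighbours and any two vertices at distance $2$ have exactly $\mu$ common neighbours. -}

module Defs where

open import Data.Nat using (ℕ; zero; suc; _≤_; _<_)
open import Data.Fin using (Fin)
open import Data.List using (List; length; filter)
open import Data.List using (allFin)
open import Data.Product using (_×_; Σ; ∃; _,_)
open import Relation.Nullary using (¬_; Dec)
open import Relation.Nullary.Decidable using (_×-dec_)
open import Relation.Unary using (Decidable)
open import Relation.Binary.PropositionalEquality using (_≡_)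
open import Level using (0ℓ)

record Graph (v : ℕ) : Set₁ where
  field
    Adj      : Fin v → Fin v → Set
    adj?     : (x y : Fin v) → Dec (Adj x y)
    sym      : ∀ {x y} → Adj x y → Adj y x
    irrefl   : ∀ {x} → ¬ Adj x x

module _ {v : ℕ} (G : Graph v) where
  open Graph G

  degree : Fin v → ℕ
  degree x = length (filter (adj? x) (allFin v))

  common : Fin v → Fin v → ℕ
  common x y = length (filter (λ w → adj? x w ×-dec adj? y w) (allFin v))

  data Walk : ℕ → Fin v → Fin v → Set where
    here : ∀ {x} → Walk zero x x
    step : ∀ {n x y z} → Adj x y → Walk n y z → Walk (suc n) x z

  Dist : Fin v → Fin v → ℕ → Set
  Dist x y n = Walk n x y × (∀ m → m < n → ¬ Walk m x y)

  Connected : Set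
  Connected = ∀ x y → Σ ℕ λ n → Walk n x y

  HasDiameter : ℕ → Set
  HasDiameter d = (∀ x y n → Dist x y n → n ≤ d) × (∃ λ x → ∃ λ y → Dist x y d)

  AmplyRegular : ℕ → ℕ → ℕ → Set
  AmplyRegular k l m =
    (∀ x → degree x ≡ k) ×
    (∀ x y → Adj x y → common x y ≡ l) ×
    (∀ x y → Dist x y 2 → common x y ≡ m)

{-# OPTIONS --safe #-}
-- Write k = 2μ + 1. On a geodesic y₀y₁y₂y₃ we have λ ≤ μ, as Γ(y₁) ∖ Γ(y₀) contains y₀ and Γ(y₁) ∩ Γ(y₃).
-- So y₃ has more than μ neighbours in Γ₂(y₀): the μ common neighbours of y₃ and y₁, and one more reached
-- through a second common neighbour of y₀ and y₂. On a geodesic of length 6 the middle vertex would then have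
-- more than 2μ + 1 neighbours, so d ≤ 5.
-- On a geodesic x₀x₁x₂x₃x₄ let N = Γ(x₁) ∩ Γ₂(x₄). Then |N| > μ, and N ∪ {x₀} ⊆ Γ(x₁) ∖ Γ(x₀) gives
-- λ + |N| < k. If λ ≥ 2, double counting the edges between N and Γ(x₀) ∩ Γ(x₁) gives |N| ≤ λ, so
-- 2μ + 2 ≤ λ + |N| ≤ 2μ; and λ = 1 is impossible since kλ is even but k is odd. Hence λ = 0.
module Submission where

open import Defs
open import Level using (Level)
open import Data.Empty using (⊥)
open import Data.Fin using (Fin)
open import Data.Fin.Properties using (any?; _≟_)
open import Data.List using (List; []; _∷_; length; filter; map; allFin)
open import Data.List.Membership.Propositional using (_∈_; lose)
open import Data.List.Membership.Propositional.Properties using (∈-filter⁻; ∈-allFin)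
open import Data.List.Properties using (filter-≐; filter-some; filter-reject)
open import Data.List.Relation.Binary.Sublist.Propositional using (⊆-refl)
open import Data.List.Relation.Binary.Sublist.Propositional.Properties using (length-mono-≤; filter⁺)
open import Data.List.Relation.Unary.All as All using (All; []; _∷_)
open import Data.List.Relation.Unary.All.Properties using (all-filter)
open import Data.List.Relation.Unary.AllPairs using (_∷_)
open import Data.List.Relation.Unary.Any using (here; there)
open import Data.List.Relation.Unary.Unique.Propositional using (Unique)
import Data.List.Relation.Unary.Unique.Propositional.Properties as Unique
open import Data.Nat using (ℕ; zero; suc; pred; _+_; _*_; _≤_; _<_; _<?_; z≤n; s≤s; s≤s⁻¹; >-nonZero)
open import Data.Nat.Divisibility using (_∣_; _∣0; m∣m*n; ∣m∣n⇒∣m+n; ∣m+n∣m⇒∣n; ∣1⇒≡1)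
open import Data.Nat.ListAction using (sum)
open import Data.Nat.Properties
  using ( +-assoc; +-comm; +-identityʳ; +-suc; *-identityʳ; +-commutativeSemigroup
        ; ≤-reflexive; <-irrefl; <-asym; <-≤-trans; <⇒≱; ≰⇒>; ≮⇒≥; n<1⇒n≡0; m≤n⇒m<n∨m≡n; m<m+n
        ; +-mono-≤; +-monoˡ-<; +-monoʳ-<; pred-mono-≤
        ; +-cancelˡ-≡; +-cancelʳ-≤; *-cancelˡ-≤; *-cancelʳ-≤; m≤n⇒∃[o]m+o≡n; module ≤-Reasoning )
open import Algebra.Properties.CommutativeSemigroup +-commutativeSemigroup using (x∙yz≈y∙xz)
open import Data.Nat.Tactic.RingSolver using (solve-∀)
open import Data.Product using (_×_; ∃; _,_; proj₁; proj₂; swap)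
open import Data.Sum using ([_,_]′)
open import Function using (_∘_)
open import Relation.Binary.Definitions using (DecidableEquality)
open import Relation.Binary.PropositionalEquality
  using (_≡_; _≢_; refl; sym; trans; cong; cong₂; subst; module ≡-Reasoning)
open import Relation.Nullary using (¬_; yes; no; contradiction)
open import Relation.Nullary.Decidable using (True; toWitness; decidable-stable; ¬?; _×-dec_)
open import Relation.Unary using (Pred; Decidable; _⊆_; _≐_; _∩_; _∖_)
open import Relation.Unary.Properties using (_∩?_; ∁?)

private variable
  ℓ ℓ′ : Level
  A B : Set ℓ

2*m+1≡m+[m+1] : ∀ m → 2 * m + 1 ≡ m + (m + 1)
2*m+1≡m+[m+1] = solve-∀

2*m+1≡1+[m+m] : ∀ m → 2 * m + 1 ≡ suc (m + m)
2*m+1≡1+[m+m] = solve-∀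

a+m<2*m+1⇒a≤m : ∀ {a m} → a + m < 2 * m + 1 → a ≤ m
a+m<2*m+1⇒a≤m {a} {m} a+m<2m+1 = +-cancelʳ-≤ m a m (s≤s⁻¹ (subst (a + m <_) (2*m+1≡1+[m+m] m) a+m<2m+1))

2*m+1<a+b : ∀ {m a b} → m < a → m < b → 2 * m + 1 < a + b
2*m+1<a+b {m} {a} {b} m<a m<b =
  subst (_≤ a + b) (cong suc (trans (+-suc m m) (sym (2*m+1≡1+[m+m] m)))) (+-mono-≤ m<a m<b)

2∤2*m+1 : ∀ m → ¬ 2 ∣ 2 * m + 1
2∤2*m+1 m 2∣2m+1 = contradiction (∣1⇒≡1 (∣m+n∣m⇒∣n 2∣2m+1 (m∣m*n m))) λ ()

_∖?_ : {P : Pred A ℓ} {Q : Pred A ℓ′} → Decidable P → Decidable Q → Decidable (P ∖ Q)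
P? ∖? Q? = P? ∩? ∁? Q?

count : {P : Pred A ℓ} → Decidable P → List A → ℕ
count P? xs = length (filter P? xs)

module _ {P : Pred A ℓ} {Q : Pred A ℓ′} (P? : Decidable P) (Q? : Decidable Q) where

  count-mono : P ⊆ Q → ∀ xs → count P? xs ≤ count Q? xs
  count-mono P⊆Q xs = length-mono-≤ (filter⁺ P? Q? (λ { refl → P⊆Q }) (⊆-refl {x = xs}))

  count-cong : P ≐ Q → ∀ xs → count P? xs ≡ count Q? xs
  count-cong P≐Q xs = cong length (filter-≐ P? Q? P≐Q xs)

  count-split : ∀ xs → count P? xs ≡ count (P? ∩? Q?) xs + count (P? ∖? Q?) xs
  count-split [] = refl
  count-split (x ∷ xs) with P? x | Q? x
  ... | yes _ | yes _ = cong suc (count-split xs)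
  ... | yes _ | no _  = trans (cong suc (count-split xs)) (sym (+-suc _ _))
  ... | no _  | _     = count-split xs

  count-filter : ∀ xs → count Q? (filter P? xs) ≡ count (P? ∩? Q?) xs
  count-filter [] = refl
  count-filter (x ∷ xs) with P? x
  ... | no _ = count-filter xs
  ... | yes _ with Q? x
  ...   | yes _ = cong suc (count-filter xs)
  ...   | no _  = count-filter xs

module _ {R : A → B → Set ℓ} (R? : ∀ x → Decidable (R x)) where

  sum-count-∷ : ∀ y ys xs → sum (map (λ x → count (R? x) (y ∷ ys)) xs) ≡
                            count (λ x → R? x y) xs + sum (map (λ x → count (R? x) ys) xs)
  sum-count-∷ y ys [] = refl
  sum-count-∷ y ys (x ∷ xs) with ih ← sum-count-∷ y ys xs | R? x y
  ... | yes _ = cong suc (trans (cong (count (R? x) ys +_) ih)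
                                (x∙yz≈y∙xz (count (R? x) ys) (count (λ x → R? x y) xs) _))
  ... | no _  = trans (cong (count (R? x) ys +_) ih)
                      (x∙yz≈y∙xz (count (R? x) ys) (count (λ x → R? x y) xs) _)

  sum-count-swap : ∀ xs ys → sum (map (λ x → count (R? x) ys) xs) ≡
                             sum (map (λ y → count (λ x → R? x y) xs) ys)
  sum-count-swap xs [] = sum-map-zero xs
    where
    sum-map-zero : ∀ xs → sum (map (λ x → count (R? x) []) xs) ≡ 0
    sum-map-zero [] = refl
    sum-map-zero (_ ∷ xs) = sum-map-zero xs
  sum-count-swap xs (y ∷ ys) =
    trans (sum-count-∷ y ys xs) (cong (count (λ x → R? x y) xs +_) (sum-count-swap xs ys))

module _ {R : A → A → Set ℓ} (R? : ∀ x → Decidable (R x))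
         (R-sym : ∀ {x y} → R x y → R y x) (R-irrefl : ∀ {x} → ¬ R x x) where

  2∣sum-count : ∀ xs → 2 ∣ sum (map (λ x → count (R? x) xs) xs)
  2∣sum-count [] = 2 ∣0
  2∣sum-count (y ∷ xs) = subst (2 ∣_) (sym sum≡2*c+sum) (∣m∣n⇒∣m+n (m∣m*n c) (2∣sum-count xs))
    where
    open ≡-Reasoning
    c : ℕ
    c = count (R? y) xs
    sum≡2*c+sum : sum (map (λ x → count (R? x) (y ∷ xs)) (y ∷ xs)) ≡
                  2 * c + sum (map (λ x → count (R? x) xs) xs)
    sum≡2*c+sum = begin
      count (R? y) (y ∷ xs) + sum (map (λ x → count (R? x) (y ∷ xs)) xs)
        ≡⟨ cong₂ _+_ (cong length (filter-reject (R? y) R-irrefl)) (sum-count-∷ R? y xs xs) ⟩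
      c + (count (λ x → R? x y) xs + sum (map (λ x → count (R? x) xs) xs))
        ≡⟨ cong (λ c′ → c + (c′ + _)) (count-cong (λ x → R? x y) (R? y) (R-sym , R-sym) xs) ⟩
      c + (c + sum (map (λ x → count (R? x) xs) xs))
        ≡⟨ +-assoc c c _ ⟨
      c + c + sum (map (λ x → count (R? x) xs) xs)
        ≡⟨ cong (λ c′ → c + c′ + _) (+-identityʳ c) ⟨
      2 * c + sum (map (λ x → count (R? x) xs) xs) ∎

module _ (_≟_ : DecidableEquality A) where

  Unique⇒∃≢ : ∀ {xs} → Unique xs → 2 ≤ length xs → (y : A) → ∃ λ x → x ∈ xs × x ≢ y
  Unique⇒∃≢ {_ ∷ []} _ (s≤s ())
  Unique⇒∃≢ {x ∷ x′ ∷ _} ((x≢x′ ∷ _) ∷ _) _ y with x ≟ y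
  ... | yes refl = x′ , there (here refl) , x≢x′ ∘ sym
  ... | no x≢y   = x , here refl , x≢y

module _ (f : A → ℕ) {c : ℕ} where

  length*≤sum-map : ∀ {xs} → All (λ x → c ≤ f x) xs → length xs * c ≤ sum (map f xs)
  length*≤sum-map []         = z≤n
  length*≤sum-map (c≤ ∷ c≤s) = +-mono-≤ c≤ (length*≤sum-map c≤s)

  sum-map≤length* : ∀ {xs} → All (λ x → f x ≤ c) xs → sum (map f xs) ≤ length xs * c
  sum-map≤length* []         = z≤n
  sum-map≤length* (≤c ∷ ≤cs) = +-mono-≤ ≤c (sum-map≤length* ≤cs)

  sum-map≡length* : ∀ {xs} → All (λ x → f x ≡ c) xs → sum (map f xs) ≡ length xs * c
  sum-map≡length* []         = refl
  sum-map≡length* (≡c ∷ ≡cs) = cong₂ _+_ ≡c (sum-map≡length* ≡cs)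

module _ {v : ℕ} where

  card : {P : Pred (Fin v) ℓ} → Decidable P → ℕ
  card P? = count P? (allFin v)

  card-< : {P : Pred (Fin v) ℓ} {Q : Pred (Fin v) ℓ′} (P? : Decidable P) (Q? : Decidable Q) →
           Q ⊆ P → ∀ {z} → P z → ¬ Q z → card Q? < card P?
  card-< P? Q? Q⊆P {z} Pz ¬Qz = begin-strict
    card Q?                           ≤⟨ count-mono Q? (P? ∩? Q?) (λ Qx → Q⊆P Qx , Qx) (allFin v) ⟩
    card (P? ∩? Q?)                   <⟨ m<m+n _ (filter-some (P? ∖? Q?) (lose (∈-allFin z) (Pz , ¬Qz))) ⟩
    card (P? ∩? Q?) + card (P? ∖? Q?) ≡⟨ count-split P? Q? (allFin v) ⟨
    card P?                           ∎
    where open ≤-Reasoning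

  2≤card⇒∃≢ : {P : Pred (Fin v) ℓ} (P? : Decidable P) → 2 ≤ card P? → (y : Fin v) → ∃ λ x → P x × x ≢ y
  2≤card⇒∃≢ P? 2≤∣P∣ y with Unique⇒∃≢ _≟_ (Unique.filter⁺ P? (Unique.allFin⁺ v)) 2≤∣P∣ y
  ... | x , x∈P , x≢y = x , proj₂ (∈-filter⁻ P? {xs = allFin v} x∈P) , x≢y

module GraphProperties {v : ℕ} (G : Graph v) where
  open Graph G renaming (sym to adj-sym)

  private variable
    a b j n : ℕ
    x y z : Fin v

  _++ʷ_ : Walk G a x y → Walk G b y z → Walk G (a + b) x z
  here     ++ʷ w′ = w′
  step e w ++ʷ w′ = step e (w ++ʷ w′)

  _∷ʳ_ : Walk G a x y → Adj y z → Walk G (suc a) x z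
  here     ∷ʳ e′ = step e′ here
  step e w ∷ʳ e′ = step e (w ∷ʳ e′)

  reverse : Walk G a x y → Walk G a y x
  reverse here       = here
  reverse (step e w) = reverse w ∷ʳ adj-sym e

  splitAt : ∀ a → Walk G (a + b) x y → ∃ λ z → Walk G a x z × Walk G b z y
  splitAt zero    w          = _ , here , w
  splitAt (suc a) (step e w) with z , w₁ , w₂ ← splitAt a w = z , step e w₁ , w₂

  Dist≥ : Fin v → Fin v → ℕ → Set
  Dist≥ x y n = ∀ j → j < n → ¬ Walk G j x y

  -- The bound j < n is decided by evaluation, so a concrete shortcut needs no proof of it.
  shortcut : Dist≥ x y n → (w : Walk G j x y) → {True (j <? n)} → ⊥
  shortcut far w {j<n} = far _ (toWitness j<n) w

  Dist≥-sym : Dist≥ x y n → Dist≥ y x n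
  Dist≥-sym far j j<n w = far j j<n (reverse w)

  Dist≥-prefix : Walk G b z y → Dist≥ x y (a + b) → Dist≥ x z a
  Dist≥-prefix {b = b} w₂ far j j<a w = far (j + b) (+-monoˡ-< b j<a) (w ++ʷ w₂)

  Dist≥-suffix : Walk G a x z → Dist≥ x y (a + b) → Dist≥ z y b
  Dist≥-suffix {a = a} w₁ far j j<b w = far (a + j) (+-monoʳ-< a j<b) (w₁ ++ʷ w)

  Dist-prefix : ∀ a → Dist G x y (a + b) → ∃ λ z → Dist G x z a
  Dist-prefix a (w , far) with z , w₁ , w₂ ← splitAt a w = z , w₁ , Dist≥-prefix w₂ far

  dist₂ : Walk G 2 x y → x ≢ y → ¬ Adj x y → Dist G x y 2
  dist₂ {x} {y} w x≢y ¬x-y = w , shorter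
    where
    shorter : Dist≥ x y 2
    shorter 0 _ here                 = x≢y refl
    shorter 1 _ (step x-y here)      = ¬x-y x-y
    shorter (suc (suc _)) (s≤s (s≤s ())) _

  SharesNeighbour : Fin v → Fin v → Set
  SharesNeighbour x y = ∃ λ z → Adj x z × Adj y z

  sharesNeighbour? : ∀ x → Decidable (SharesNeighbour x)
  sharesNeighbour? x y = any? (adj? x ∩? adj? y)

  common-comm : ∀ x y → common G x y ≡ common G y x
  common-comm x y = count-cong (adj? x ∩? adj? y) (adj? y ∩? adj? x) (swap , swap) (allFin v)

module AmplyRegularGraph {v : ℕ} (G : Graph v) {k l m : ℕ} (AR : AmplyRegular G k l m) where
  open Graph G renaming (sym to adj-sym)
  open GraphProperties G

  private variable
    a b b′ x y x₀ x₁ x₂ x₃ y₀ y₁ y₂ y₃ : Fin v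

  degree≡k : ∀ x → degree G x ≡ k
  degree≡k = proj₁ AR

  common≡λ : Adj x y → common G x y ≡ l
  common≡λ = proj₁ (proj₂ AR) _ _

  common≡μ : Dist G x y 2 → common G x y ≡ m
  common≡μ = proj₂ (proj₂ AR) _ _

  common≤μ : l ≤ m → b ≢ b′ → Adj a b → Adj a b′ → common G b b′ ≤ m
  common≤μ {b} {b′} λ≤μ b≢b′ a-b a-b′ with adj? b b′
  ... | yes b-b′ = subst (_≤ m) (sym (common≡λ b-b′)) λ≤μ
  ... | no ¬b-b′ = ≤-reflexive (common≡μ (dist₂ (step (adj-sym a-b) (step a-b′ here)) b≢b′ ¬b-b′))

  -- Otherwise Γ(x) ∩ Γ(b′) and a would all lie in Γ(b) ∩ Γ(b′), which has at most max(λ, μ) = μ elements.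
  common-neighbour-outside : l ≤ m → b ≢ b′ → Adj a b → Adj a b′ → ¬ Adj a x → common G x b′ ≡ m →
                             ∃ λ z → Adj x z × Adj b′ z × ¬ Adj b z
  common-neighbour-outside {b} {b′} {a} {x} λ≤μ b≢b′ a-b a-b′ ¬a-x common≡m =
    decidable-stable (any? λ z → adj? x z ×-dec adj? b′ z ×-dec ¬? (adj? b z)) ¬¬outside
    where
    ¬¬outside : ¬ ¬ ∃ λ z → Adj x z × Adj b′ z × ¬ Adj b z
    ¬¬outside ∄ = <⇒≱ (subst (_< common G b b′) common≡m
                          (card-< (adj? b ∩? adj? b′) (adj? x ∩? adj? b′) inside
                                  (adj-sym a-b , adj-sym a-b′) (¬a-x ∘ adj-sym ∘ proj₁)))
                      (common≤μ λ≤μ b≢b′ a-b a-b′)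
      where
      inside : Adj x ∩ Adj b′ ⊆ Adj b ∩ Adj b′
      inside {w} (x-w , b′-w) =
        decidable-stable (adj? b w) (λ ¬b-w → ∄ (w , x-w , b′-w , ¬b-w)) , b′-w

  -- A neighbour of y₃ shares a neighbour with y₀ iff it lies in Γ₂(y₀): the count is c₃(y₀, y₃).
  μ<c₃ : 2 ≤ m → l ≤ m → Adj y₀ y₁ → Adj y₁ y₂ → Adj y₂ y₃ → Dist≥ y₀ y₃ 3 →
         m < card (adj? y₃ ∩? sharesNeighbour? y₀)
  μ<c₃ {y₀} {y₁} {y₂} {y₃} 2≤μ λ≤μ a₀₁ a₁₂ a₂₃ far =
    let y₁′ , (a₀₁′ , a₂₁′) , y₁′≢y₁ = 2≤card⇒∃≢ (adj? y₀ ∩? adj? y₂) 2≤common₀₂ y₁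
        z , a₃z , a₁′z , ¬a₁z = common-neighbour-outside λ≤μ (y₁′≢y₁ ∘ sym) a₀₁ a₀₁′
                                  (λ a₀₃ → shortcut far (step a₀₃ here))
                                  (common≡μ (dist₃₂ a₀₁′ (adj-sym a₂₁′)))
    in subst (_< _) (common≡μ (dist₃₂ a₀₁ a₁₂))
         (card-< (adj? y₃ ∩? sharesNeighbour? y₀) (adj? y₃ ∩? adj? y₁) via-y₁
                 (a₃z , y₁′ , a₀₁′ , adj-sym a₁′z) (¬a₁z ∘ proj₂))
    where
    2≤common₀₂ : 2 ≤ common G y₀ y₂
    2≤common₀₂ = subst (2 ≤_) (sym (common≡μ dist₀₂)) 2≤μ
      where
      dist₀₂ = dist₂ (step a₀₁ (step a₁₂ here)) (λ { refl → shortcut far (step a₂₃ here) })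
                 (λ a₀₂ → shortcut far (step a₀₂ (step a₂₃ here)))
    dist₃₂ : ∀ {u} → Adj y₀ u → Adj u y₂ → Dist G y₃ u 2
    dist₃₂ a₀u au₂ = dist₂ (step (adj-sym a₂₃) (step (adj-sym au₂) here))
                       (λ { refl → shortcut far (step a₀u here) })
                       (λ a₃u → shortcut far (step a₀u (step (adj-sym a₃u) here)))
    via-y₁ : Adj y₃ ∩ Adj y₁ ⊆ Adj y₃ ∩ SharesNeighbour y₀
    via-y₁ (a₃w , a₁w) = a₃w , y₁ , a₀₁ , adj-sym a₁w

  λ+card<k : {Q : Pred (Fin v) ℓ} (Q? : Decidable Q) → Adj x y → Q ⊆ Adj x ∖ Adj y → ¬ Q y → l + card Q? < k
  λ+card<k {x = x} {y} Q? x-y Q⊆ ¬Qy = begin-strict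
    l + card Q?                            <⟨ +-monoʳ-< l (card-< (adj? x ∖? adj? y) Q? Q⊆ (x-y , irrefl) ¬Qy) ⟩
    l + card (adj? x ∖? adj? y)            ≡⟨ cong (_+ _) (common≡λ x-y) ⟨
    common G x y + card (adj? x ∖? adj? y) ≡⟨ count-split (adj? x) (adj? y) (allFin v) ⟨
    degree G x                             ≡⟨ degree≡k x ⟩
    k                                      ∎
    where open ≤-Reasoning

  λ+μ<k : Adj x₀ x₁ → Adj x₁ x₂ → Adj x₂ x₃ → Dist≥ x₀ x₃ 3 → l + m < k
  λ+μ<k {x₀} {x₁} {x₂} {x₃} a₀₁ a₁₂ a₂₃ far =
    subst (λ c → l + c < k) (common≡μ dist₁₃)
      (λ+card<k (adj? x₁ ∩? adj? x₃) (adj-sym a₀₁)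
        (λ (a₁w , a₃w) → a₁w , λ a₀w → shortcut far (step a₀w (step (adj-sym a₃w) here)))
        (λ (_ , a₃₀) → shortcut far (step (adj-sym a₃₀) here)))
    where
    dist₁₃ : Dist G x₁ x₃ 2
    dist₁₃ = dist₂ (step a₁₂ (step a₂₃ here)) (λ { refl → shortcut far (step a₀₁ here) })
               (λ a₁₃ → shortcut far (step a₀₁ (step a₁₃ here)))

  -- The handshake lemma in the λ-regular graph induced on Γ(x).
  2∣k*λ : Fin v → 2 ∣ k * l
  2∣k*λ x = subst (2 ∣_) sum≡k*λ (2∣sum-count adj? adj-sym irrefl Γx)
    where
    Γx : List (Fin v)
    Γx = filter (adj? x) (allFin v)
    sum≡k*λ : sum (map (λ y → count (adj? y) Γx) Γx) ≡ k * l
    sum≡k*λ = trans (sum-map≡length* (λ y → count (adj? y) Γx)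
                                     (All.map common-Γx≡λ (all-filter (adj? x) (allFin v))))
                    (cong (_* l) (degree≡k x))
      where
      common-Γx≡λ : Adj x y → count (adj? y) Γx ≡ l
      common-Γx≡λ x-y = trans (count-filter (adj? x) (adj? _) (allFin v)) (common≡λ x-y)

module OddValency {v : ℕ} (G : Graph v) {k l m : ℕ} (AR : AmplyRegular G k l m)
                  (k≡2m+1 : k ≡ 2 * m + 1) (2≤μ : 2 ≤ m) where
  open Graph G renaming (sym to adj-sym)
  open GraphProperties G
  open AmplyRegularGraph G AR

  private variable
    p w x y x₀ x₁ x₂ x₃ x₄ x₆ : Fin v

  Dist≥₃⇒λ≤μ : Adj x₀ x₁ → Adj x₁ x₂ → Adj x₂ x₃ → Dist≥ x₀ x₃ 3 → l ≤ m
  Dist≥₃⇒λ≤μ a₀₁ a₁₂ a₂₃ far = a+m<2*m+1⇒a≤m (subst (l + m <_) k≡2m+1 (λ+μ<k a₀₁ a₁₂ a₂₃ far))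

  λ≢1 : Fin v → l ≢ 1
  λ≢1 x λ≡1 = 2∤2*m+1 m (subst (2 ∣_) (trans (cong (k *_) λ≡1) (trans (*-identityʳ k) k≡2m+1)) (2∣k*λ x))

  one-neighbour-outside : Dist G x w 2 → Dist G w y 2 → (∀ {z} → Adj x z → ¬ Adj y z) →
                          card ((adj? w ∖? adj? x) ∖? adj? y) ≡ 1
  one-neighbour-outside {x} {w} {y} dist-xw dist-wy disjoint =
    +-cancelˡ-≡ m _ 1 (+-cancelˡ-≡ m _ (m + 1) (begin
      m + (m + card outside?)
        ≡⟨ cong₂ (λ a b → a + (b + card outside?)) common-wx common-wy ⟨
      common G w x + (card (Γw∖Γx? ∩? adj? y) + card outside?)
        ≡⟨ cong (common G w x +_) (count-split Γw∖Γx? (adj? y) (allFin v)) ⟨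
      common G w x + card Γw∖Γx?
        ≡⟨ count-split (adj? w) (adj? x) (allFin v) ⟨
      degree G w
        ≡⟨ trans (degree≡k w) k≡2m+1 ⟩
      2 * m + 1
        ≡⟨ 2*m+1≡m+[m+1] m ⟩
      m + (m + 1) ∎))
    where
    open ≡-Reasoning
    Γw∖Γx? = adj? w ∖? adj? x
    outside? = Γw∖Γx? ∖? adj? y
    common-wx : common G w x ≡ m
    common-wx = trans (common-comm w x) (common≡μ dist-xw)
    common-wy : card (Γw∖Γx? ∩? adj? y) ≡ m
    common-wy = trans (count-cong (Γw∖Γx? ∩? adj? y) (adj? w ∩? adj? y)
                        ((λ ((w-z , _) , y-z) → w-z , y-z) ,
                         (λ (w-z , y-z) → (w-z , λ x-z → disjoint x-z y-z) , y-z))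
                        (allFin v))
                      (common≡μ dist-wy)

  module Geodesic₄ (a₀₁ : Adj x₀ x₁) (a₁₂ : Adj x₁ x₂) (a₂₃ : Adj x₂ x₃) (a₃₄ : Adj x₃ x₄)
                   (far : Dist≥ x₀ x₄ 4) where

    N? : Decidable (Adj x₁ ∩ SharesNeighbour x₄)
    N? = adj? x₁ ∩? sharesNeighbour? x₄

    P? : Decidable (Adj x₀ ∩ Adj x₁)
    P? = adj? x₀ ∩? adj? x₁

    N P : List (Fin v)
    N = filter N? (allFin v)
    P = filter P? (allFin v)

    x₀∉N : ¬ SharesNeighbour x₄ x₀
    x₀∉N (_ , a₄c , a₀c) = shortcut far (step a₀c (step (adj-sym a₄c) here))

    μ<|N| : m < card N?
    μ<|N| = μ<c₃ 2≤μ (Dist≥₃⇒λ≤μ a₀₁ a₁₂ a₂₃ (Dist≥-prefix (step a₃₄ here) far))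
                 (adj-sym a₃₄) (adj-sym a₂₃) (adj-sym a₁₂) (Dist≥-sym (Dist≥-suffix (step a₀₁ here) far))

    λ+|N|<k : l + card N? < k
    λ+|N|<k = λ+card<k N? (adj-sym a₀₁)
                (λ (a₁w , _ , a₄c , awc) →
                   a₁w , λ a₀w → shortcut far (step a₀w (step awc (step (adj-sym a₄c) here))))
                (x₀∉N ∘ proj₂)

    -- At most one of the λ common neighbours of w and x₁ lies outside Γ(x₀), namely the unique
    -- neighbour of w outside Γ(x₀) ∪ Γ(x₄).
    λ-1≤|Γw∩P| : Adj x₁ w × SharesNeighbour x₄ w → pred l ≤ count (adj? w) P
    λ-1≤|Γw∩P| {w} (a₁w , _ , a₄c , awc) = pred-mono-≤ (begin
      l
        ≡⟨ common≡λ (adj-sym a₁w) ⟨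
      common G w x₁
        ≡⟨ count-split (adj? w ∩? adj? x₁) (adj? x₀) (allFin v) ⟩
      card ((adj? w ∩? adj? x₁) ∩? adj? x₀) + card ((adj? w ∩? adj? x₁) ∖? adj? x₀)
        ≤⟨ +-mono-≤ (≤-reflexive in-P) in-outside ⟩
      count (adj? w) P + card outside?
        ≡⟨ cong (count (adj? w) P +_) (one-neighbour-outside dist₀w dist-w₄ disjoint) ⟩
      count (adj? w) P + 1
        ≡⟨ +-comm _ 1 ⟩
      1 + count (adj? w) P ∎)
      where
      open ≤-Reasoning
      outside? = (adj? w ∖? adj? x₀) ∖? adj? x₄
      dist₀w : Dist G x₀ w 2
      dist₀w = dist₂ (step a₀₁ (step a₁w here)) (λ { refl → shortcut far (step awc (step (adj-sym a₄c) here)) })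
                 (λ a₀w → shortcut far (step a₀w (step awc (step (adj-sym a₄c) here))))
      dist-w₄ : Dist G w x₄ 2
      dist-w₄ = dist₂ (step awc (step (adj-sym a₄c) here)) (λ { refl → shortcut far (step a₀₁ (step a₁w here)) })
                  (λ aw₄ → shortcut far (step a₀₁ (step a₁w (step aw₄ here))))
      disjoint : ∀ {z} → Adj x₀ z → ¬ Adj x₄ z
      disjoint a₀z a₄z = shortcut far (step a₀z (step (adj-sym a₄z) here))
      in-P : card ((adj? w ∩? adj? x₁) ∩? adj? x₀) ≡ count (adj? w) P
      in-P = trans (count-cong ((adj? w ∩? adj? x₁) ∩? adj? x₀) (P? ∩? adj? w)
                     ((λ ((a , b) , c) → (c , b) , a) , λ ((c , b) , a) → (a , b) , c) (allFin v))
                   (sym (count-filter P? (adj? w) (allFin v)))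
      in-outside : card ((adj? w ∩? adj? x₁) ∖? adj? x₀) ≤ card outside?
      in-outside = count-mono ((adj? w ∩? adj? x₁) ∖? adj? x₀) outside?
                     (λ ((w-z , a₁z) , ¬a₀z) →
                        (w-z , ¬a₀z) , λ a₄z → shortcut far (step a₀₁ (step a₁z (step (adj-sym a₄z) here))))
                     (allFin v)

    |Γp∩N|<λ : Adj x₀ p × Adj x₁ p → count (λ w → adj? w p) N < l
    |Γp∩N|<λ {p} (a₀p , a₁p) = begin-strict
      count (λ w → adj? w p) N
        ≡⟨ count-filter N? (λ w → adj? w p) (allFin v) ⟩
      card (N? ∩? λ w → adj? w p)
        <⟨ card-< (adj? p ∩? adj? x₁) (N? ∩? λ w → adj? w p) (λ ((a₁w , _) , awp) → adj-sym awp , a₁w)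
                  (adj-sym a₀p , adj-sym a₀₁) (x₀∉N ∘ proj₂ ∘ proj₁) ⟩
      common G p x₁
        ≡⟨ common≡λ (adj-sym a₁p) ⟩
      l ∎
      where open ≤-Reasoning

    |N|≤λ : 2 ≤ l → card N? ≤ l
    |N|≤λ 2≤λ = *-cancelʳ-≤ (card N?) l (pred l) {{>-nonZero (pred-mono-≤ 2≤λ)}} (begin
      card N? * pred l
        ≤⟨ length*≤sum-map (λ w → count (adj? w) P) (All.map λ-1≤|Γw∩P| (all-filter N? (allFin v))) ⟩
      sum (map (λ w → count (adj? w) P) N)
        ≡⟨ sum-count-swap adj? N P ⟩
      sum (map (λ p → count (λ w → adj? w p) N) P)
        ≤⟨ sum-map≤length* (λ p → count (λ w → adj? w p) N)
                           (All.map (pred-mono-≤ ∘ |Γp∩N|<λ) (all-filter P? (allFin v))) ⟩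
      common G x₀ x₁ * pred l
        ≡⟨ cong (_* pred l) (common≡λ a₀₁) ⟩
      l * pred l ∎)
      where open ≤-Reasoning

    λ<2 : l < 2
    λ<2 = ≰⇒> λ 2≤λ → <-asym (2*m+1<a+b (<-≤-trans μ<|N| (|N|≤λ 2≤λ)) μ<|N|)
                              (subst (l + card N? <_) k≡2m+1 λ+|N|<k)

    λ≡0 : l ≡ 0
    λ≡0 = [ n<1⇒n≡0 , (λ λ≡1 → contradiction λ≡1 (λ≢1 x₀)) ]′ (m≤n⇒m<n∨m≡n (s≤s⁻¹ λ<2))

  Dist₄⇒λ≡0 : Dist G x₀ x₄ 4 → l ≡ 0
  Dist₄⇒λ≡0 (step a₀₁ (step a₁₂ (step a₂₃ (step a₃₄ here))) , far) = Geodesic₄.λ≡0 a₀₁ a₁₂ a₂₃ a₃₄ far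

  ¬Dist₆ : l ≤ m → ¬ Dist G x₀ x₆ 6
  ¬Dist₆ {x₀} {x₆} λ≤μ (step a₀₁ (step a₁₂ (step a₂₃ (step {x = x₃} a₃₄ (step a₄₅ (step a₅₆ here))))) , far) =
    <-irrefl refl (begin-strict
      2 * m + 1
        <⟨ 2*m+1<a+b near₀ (<-≤-trans near₆ disjoint) ⟩
      card (adj? x₃ ∩? sharesNeighbour? x₀) + card (adj? x₃ ∖? sharesNeighbour? x₀)
        ≡⟨ count-split (adj? x₃) (sharesNeighbour? x₀) (allFin v) ⟨
      degree G x₃
        ≡⟨ trans (degree≡k x₃) k≡2m+1 ⟩
      2 * m + 1 ∎)
    where
    open ≤-Reasoning
    near₀ : m < card (adj? x₃ ∩? sharesNeighbour? x₀)
    near₀ = μ<c₃ 2≤μ λ≤μ a₀₁ a₁₂ a₂₃ (Dist≥-prefix (step a₃₄ (step a₄₅ (step a₅₆ here))) far)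
    near₆ : m < card (adj? x₃ ∩? sharesNeighbour? x₆)
    near₆ = μ<c₃ 2≤μ λ≤μ (adj-sym a₅₆) (adj-sym a₄₅) (adj-sym a₃₄)
              (Dist≥-sym (Dist≥-suffix (step a₀₁ (step a₁₂ (step a₂₃ here))) far))
    disjoint : card (adj? x₃ ∩? sharesNeighbour? x₆) ≤ card (adj? x₃ ∖? sharesNeighbour? x₀)
    disjoint = count-mono (adj? x₃ ∩? sharesNeighbour? x₆) (adj? x₃ ∖? sharesNeighbour? x₀)
                 (λ (a₃w , _ , a₆c′ , awc′) → a₃w , λ (_ , a₀c , awc) →
                    shortcut far (step a₀c (step (adj-sym awc) (step awc′ (step (adj-sym a₆c′) here)))))
                 (allFin v)

lemma3p3 : {v : ℕ} (G : Graph v) (d k l m : ℕ) →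
    Connected G → HasDiameter G d → 4 ≤ d →
    AmplyRegular G k l m →
    5 ≤ k → k ≡ 2 * m + 1 →
    (l ≡ 0) × (d ≤ 5)
lemma3p3 G d k l m _ (_ , x , y , dist-xy) 4≤d AR 5≤k k≡2m+1 = λ≡0 , d≤5
  where
  2≤μ : 2 ≤ m
  2≤μ = *-cancelˡ-≤ 2 (+-cancelʳ-≤ 1 4 (2 * m) (subst (5 ≤_) k≡2m+1 5≤k))

  open GraphProperties G
  open OddValency G AR k≡2m+1 2≤μ

  from-x : ∀ n → n ≤ d → ∃ λ z → Dist G x z n
  from-x n n≤d with o , n+o≡d ← m≤n⇒∃[o]m+o≡n n≤d =
    Dist-prefix n (subst (Dist G x y) (sym n+o≡d) dist-xy)

  λ≡0 : l ≡ 0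
  λ≡0 = Dist₄⇒λ≡0 (proj₂ (from-x 4 4≤d))

  d≤5 : d ≤ 5
  d≤5 = ≮⇒≥ λ 5<d → ¬Dist₆ (subst (_≤ m) (sym λ≡0) z≤n) (proj₂ (from-x 6 5<d))
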